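{- Let $F$ be a semi-skyline augmented filling and $k$ a positive integer, and run the insertion $k\rightarrow F$, producing the insertion sequence $(x_1,\dots,x_r)$ and the cells $p_1,\dots,p_r$ (where $x_i$ is placed into $p_i$). For each $i$, let $\alpha_i$ be the first cell of $F$ (in reading order, basement included) that comes strictly after $p_{i-1}$ in reading order and whose entry in $F$ equals $x_i$ (for $i=1$, the first cell of $F$ in reading order with entry $x_1$). Then the cell $p_i$ into which $x_i$ is inserted lies in a row strictly higher than the row of $\alpha_i$.
   Context: Weak compositions $\gamma=(\gamma_1,\gamma_2,\dots)$ have infinitely many parts, finitely many nonzero. The augmented diagram of $\gamma$ consists of cells $(i,j)$, $i\ge1$, $0\le j\le\gamma_i$; row $0$ is the basement; column $i$ has height $\gamma_i$. An augmented filling $F$ assigns a positive integer to each cell with $F(i,0)=i$. A descent is a pair $(i,j+1),(i,j)$ with $F(i,j+1)>F(i,j)$. $I(x,y)=1$ if $x>y$, else $0$. A type A triple: cells $a_1=(i_1,j)$, $a_2=(i_2,j)$, $a_3=(i_1,j-1)$, $j\ge1$, $i_1<i_2$, $\gamma_{i_1}\ge\gamma_{i_2}$; inversion triple if $I(F(a_1),F(a_2))+I(F(a_2),F(a_3))-I(F(a_1),F(a_3))=1$. A type B triple: cells $a_1=(i_1,j)$, $a_2=(i_2,j)$, $a_3=(i_2,j+1)$, $j\ge0$, $i_1<i_2$, $\gamma_{i_2}>\gamma_{i_1}$; inversion triple if $I(F(a_3),F(a_1))+I(F(a_1),F(a_2))-I(F(a_3),F(a_2))=1$. A semi-skyline augmented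 filling (SSAF) is an augmented filling with no descents in which every type A and type B triple is an inversion triple. Reading order: cells are read row by row from the highest row down to the basement, each row from left to right. Insertion $k\rightarrow F$: list the cells of $F$ (basement included) in reading order as $c_1,c_2,\dots$; for a cell $c$ let $\hat c$ be the position directly above it, with value $F(\hat c)=0$ if that position is not a cell. Set $x_1=k$, $i=1$, $j=1$. Repeat: if $F(c_j)<x_i$ or $F(\hat c_j)\ge x_i$, increase $j$ by $1$; otherwise set $x_{i+1}:=F(\hat c_j)$, put $x_i$ into position $\hat c_j$ (creating a new cell if it was empty), set $p_i:=\hat c_j$, and if $x_{i+1}\neq0$ increase $i$ and $j$ by $1$ and continue, while if $x_{i+1}=0$ stop. The result is $k\rightarrow F$, with insertion sequence $(x_1,\dots,x_r)$ and cells $p_1,\dots,p_r$. -}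

module Defs where

open import Data.Nat using (ℕ; zero; suc; _+_; _≤_; _<_; _<ᵇ_; _≤?_)
open import Data.Bool using (if_then_else_)
open import Data.Product using (Σ; _×_; _,_; proj₁; proj₂)
open import Data.Sum using (_⊎_)
open import Data.Maybe using (Maybe; just; nothing)
open import Data.Unit using (⊤)
open import Data.List using (List; []; _∷_)
open import Relation.Nullary using (¬_; yes; no)
open import Relation.Binary.PropositionalEquality using (_≡_)

-- A weak composition γ = (γ₁, γ₂, …): γ i is the height of column i (i ≥ 1);
-- the value γ 0 is irrelevant (there is no column 0).
IsWeakComposition : (ℕ → ℕ) → Set
IsWeakComposition γ = Σ ℕ λ N → ∀ i → N < i → γ i ≡ 0

Cell : Set
Cell = ℕ × ℕ

col row : Cell → ℕ
col = proj₁
row = proj₂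

IsCell : (ℕ → ℕ) → Cell → Set
IsCell γ (i , j) = 1 ≤ i × j ≤ γ i

above : Cell → Cell
above (i , j) = (i , suc j)

-- A filling assigns a number F i j to position (i , j); only its values on
-- cells of the diagram matter.  'entry' returns F's value at a position,
-- or 0 if the position is not a cell of the diagram.
entry : (ℕ → ℕ) → (ℕ → ℕ → ℕ) → Cell → ℕ
entry γ F (i , j) with 1 ≤? i | j ≤? γ i
... | yes _ | yes _ = F i j
... | _     | _     = 0

IsAugmentedFilling : (ℕ → ℕ) → (ℕ → ℕ → ℕ) → Set
IsAugmentedFilling γ F =
  (∀ i j → IsCell γ (i , j) → 1 ≤ F i j) × (∀ i → 1 ≤ i → F i 0 ≡ i)

NoDescents : (ℕ → ℕ) → (ℕ → ℕ → ℕ) → Set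
NoDescents γ F = ∀ i j → IsCell γ (i , suc j) → F i (suc j) ≤ F i j

I : ℕ → ℕ → ℕ
I x y = if y <ᵇ x then 1 else 0

-- Type A triple a1=(i1,j), a2=(i2,j), a3=(i1,j-1), j ≥ 1, i1 < i2,
-- γ i1 ≥ γ i2 (all three cells in the diagram) is an inversion triple:
-- I(a1,a2) + I(a2,a3) - I(a1,a3) = 1.
TypeAInversions : (ℕ → ℕ) → (ℕ → ℕ → ℕ) → Set
TypeAInversions γ F =
  ∀ i1 i2 j → 1 ≤ i1 → i1 < i2 → γ i2 ≤ γ i1 →
  IsCell γ (i1 , suc j) → IsCell γ (i2 , suc j) →
  I (F i1 (suc j)) (F i2 (suc j)) + I (F i2 (suc j)) (F i1 j)
    ≡ 1 + I (F i1 (suc j)) (F i1 j)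

-- Type B triple a1=(i1,j), a2=(i2,j), a3=(i2,j+1), j ≥ 0, i1 < i2,
-- γ i2 > γ i1 (all three cells in the diagram) is an inversion triple:
-- I(a3,a1) + I(a1,a2) - I(a3,a2) = 1.
TypeBInversions : (ℕ → ℕ) → (ℕ → ℕ → ℕ) → Set
TypeBInversions γ F =
  ∀ i1 i2 j → 1 ≤ i1 → i1 < i2 → γ i1 < γ i2 →
  IsCell γ (i1 , j) → IsCell γ (i2 , j) → IsCell γ (i2 , suc j) →
  I (F i2 (suc j)) (F i1 j) + I (F i1 j) (F i2 j)
    ≡ 1 + I (F i2 (suc j)) (F i2 j)

IsSSAF : (ℕ → ℕ) → (ℕ → ℕ → ℕ) → Set
IsSSAF γ F =
  IsAugmentedFilling γ F × NoDescents γ F × TypeAInversions γ F × TypeBInversions γ F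

_≺_ : Cell → Cell → Set
(i , j) ≺ (i' , j') = j' < j ⊎ (j ≡ j' × i < i')

After : Maybe Cell → Cell → Set
After nothing  c = ⊤
After (just s) c = s ≺ c

FirstCell : (ℕ → ℕ) → Maybe Cell → (Cell → Set) → Cell → Set
FirstCell γ m P c =
  IsCell γ c × After m c × P c ×
  (∀ c' → IsCell γ c' → After m c' → c' ≺ c → ¬ P c')

-- the insertion algorithm places x at ĉ for cell c iff
-- not (F(c) < x or F(ĉ) ≥ x), i.e. x ≤ F(c) and F(ĉ) < x
Places : (ℕ → ℕ) → (ℕ → ℕ → ℕ) → ℕ → Cell → Set
Places γ F x c = x ≤ entry γ F c × entry γ F (above c) < x

-- InsRun γ F m x steps : scanning the cells strictly after m (all cells if
-- m = nothing) with current value x, the insertion k → F finishes producing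
-- the remaining list of pairs (x_i , p_i).  The scan resumes right after the
-- scanned cell c_j, and entries are read from F (the positions modified
-- during insertion are never read again).
data InsRun (γ : ℕ → ℕ) (F : ℕ → ℕ → ℕ) : Maybe Cell → ℕ → List (ℕ × Cell) → Set where
  stop : ∀ {m x} c → FirstCell γ m (Places γ F x) c →
         entry γ F (above c) ≡ 0 →
         InsRun γ F m x ((x , above c) ∷ [])
  continue : ∀ {m x rest} c → FirstCell γ m (Places γ F x) c →
         ¬ entry γ F (above c) ≡ 0 →
         InsRun γ F (just c) (entry γ F (above c)) rest →
         InsRun γ F m x ((x , above c) ∷ rest)

withPrev : Maybe Cell → List (ℕ × Cell) → List (Maybe Cell × ℕ × Cell)
withPrev m [] = []
withPrev m ((x , p) ∷ r) = (m , x , p) ∷ withPrev (just p) r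

HasEntry : (ℕ → ℕ → ℕ) → ℕ → Cell → Set
HasEntry F x (i , j) = F i j ≡ x

-- The value x bumped out of a cell p sits directly above a strictly larger
-- entry.  By the semi-skyline inversion triples no cell strictly between p and
-- the cell below it in reading order carries x, so the first occurrence α of x
-- after p already lies after the cell where the scan resumes.  If α were above
-- the row of the next placement, the scan would have skipped α, which by the
-- absence of descents forces another x directly above α, contradicting that α
-- is the first occurrence.  Such an α exists: the basement holds x in row 0.
module Submission where

open import Defs
open import Data.Nat using (ℕ; zero; suc; _+_; _⊔_; _≤_; _<_; _<ᵇ_; z≤n; s≤s; z<s; s<s; _≤?_; _<?_; _≟_)
open import Data.Nat.Properties
open import Data.Nat.Induction using (<-rec)
open import Data.Bool using (false; true)
open import Data.Product using (Σ; ∃; _×_; _,_; proj₁; proj₂)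
open import Data.Sum using (_⊎_; inj₁; inj₂)
open import Data.Maybe using (Maybe; nothing; just)
open import Data.Unit using (tt)
open import Data.List using (List)
open import Data.List.Relation.Unary.All using (All; []; _∷_)
open import Relation.Nullary using (¬_; Dec; yes; no; ofʸ; contradiction)
open import Relation.Nullary.Decidable using (_×-dec_; _⊎-dec_)
open import Relation.Unary using (Pred; Decidable)
open import Relation.Binary using (tri<; tri≈; tri>)
open import Relation.Binary.PropositionalEquality using (_≡_; _≢_; refl; sym; trans; subst; subst₂)

module _ {p} {P : Pred ℕ p} (P? : Decidable P) where

  least : ∀ {n} → P n → ∃ λ m → P m × ∀ {k} → k < m → ¬ P k
  least {n} = <-rec _ search n
    where
    search : ∀ n → (∀ {m} → m < n → P m → ∃ λ m → P m × ∀ {k} → k < m → ¬ P k) →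
             P n → ∃ λ m → P m × ∀ {k} → k < m → ¬ P k
    search n smaller Pn with anyUpTo? P? n
    ... | yes (m , m<n , Pm) = smaller m<n Pm
    ... | no ∄ = n , Pn , λ k<n Pk → ∄ (_ , k<n , Pk)

  greatest : ∀ {n} H → (∀ {k} → P k → k ≤ H) → P n → ∃ λ m → P m × ∀ {k} → P k → k ≤ m
  greatest zero bounded Pn = _ , Pn , λ Pk → ≤-trans (bounded Pk) z≤n
  greatest (suc H) bounded Pn with P? (suc H)
  ... | yes PH = suc H , PH , bounded
  ... | no ¬PH = greatest H (λ Pk → ≤-pred (≤∧≢⇒< (bounded Pk) λ { refl → ¬PH Pk })) Pn

eventually-zero⇒bounded : ∀ N {f : ℕ → ℕ} → (∀ i → N < i → f i ≡ 0) → ∃ λ H → ∀ i → f i ≤ H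
eventually-zero⇒bounded zero {f} vanish = f 0 , bound
  where
  bound : ∀ i → f i ≤ f 0
  bound zero = ≤-refl
  bound (suc i) rewrite vanish (suc i) z<s = z≤n
eventually-zero⇒bounded (suc N) {f} vanish
  with eventually-zero⇒bounded N (λ i N<i → vanish (suc i) (s<s N<i))
... | H , bound = f 0 ⊔ H , bound′
  where
  bound′ : ∀ i → f i ≤ f 0 ⊔ H
  bound′ zero = m≤m⊔n (f 0) H
  bound′ (suc i) = m≤n⇒m≤o⊔n (f 0) (bound i)

≺-trichotomy : ∀ c d → c ≺ d ⊎ c ≡ d ⊎ d ≺ c
≺-trichotomy (i , j) (i′ , j′) with <-cmp j j′
... | tri> _ _ j′<j = inj₁ (inj₁ j′<j)
... | tri< j<j′ _ _ = inj₂ (inj₂ (inj₁ j<j′))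
... | tri≈ _ refl _ with <-cmp i i′
...   | tri< i<i′ _ _ = inj₁ (inj₂ (refl , i<i′))
...   | tri≈ _ refl _ = inj₂ (inj₁ refl)
...   | tri> _ _ i′<i = inj₂ (inj₂ (inj₂ (refl , i′<i)))

above-≺ : ∀ c → above c ≺ c
above-≺ (i , j) = inj₁ (n<1+n j)

above-mono-≺ : ∀ {c d} → c ≺ d → above c ≺ above d
above-mono-≺ (inj₁ lt) = inj₁ (s<s lt)
above-mono-≺ (inj₂ (refl , lt)) = inj₂ (refl , lt)

-- Only rows above the basement need bounded columns: the first cell is found
-- in the highest occupied row, and in row 0 the witness itself bounds the search.
module _ {q} {Q : Pred Cell q} (Q? : Decidable Q) {H B : ℕ}
         (row-bounded : ∀ {c} → Q c → row c ≤ H)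
         (col-bounded : ∀ {c} → Q c → 0 < row c → col c ≤ B) where

  first-in-reading-order : ∀ {c} → Q c → ∃ λ c → Q c × ∀ {c′} → c′ ≺ c → ¬ Q c′
  first-in-reading-order {i₀ , _} Qc
    with greatest occupied? H occupied-bounded (i₀ , s≤s (m≤n+m i₀ B) , Qc)
    where
    Occupied : Pred ℕ q
    Occupied j = ∃ λ i → i < suc (B + i₀) × Q (i , j)
    occupied? : Decidable Occupied
    occupied? j = anyUpTo? (λ i → Q? (i , j)) (suc (B + i₀))
    occupied-bounded : ∀ {j} → Occupied j → j ≤ H
    occupied-bounded (_ , _ , Qij) = row-bounded Qij
  ... | r , (i , _ , Qir) , highest with least (λ i → Q? (i , r)) Qir
  ...   | b , Qbr , leftmost = (b , r) , Qbr , earlier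
    where
    earlier : ∀ {c′} → c′ ≺ (b , r) → ¬ Q c′
    earlier {i′ , j′} (inj₁ r<j′) Qc′ =
      <⇒≱ r<j′ (highest (i′ , s≤s (m≤n⇒m≤n+o i₀ (col-bounded Qc′ (≤-<-trans z≤n r<j′))) , Qc′))
    earlier (inj₂ (refl , i′<b)) = leftmost i′<b

module Entries (γ : ℕ → ℕ) (F : ℕ → ℕ → ℕ) where

  entry-cell : ∀ {i j} → IsCell γ (i , j) → entry γ F (i , j) ≡ F i j
  entry-cell {i} {j} (1≤i , j≤γi) with 1 ≤? i | j ≤? γ i
  ... | yes _ | yes _ = refl
  ... | no 1≰i | _ = contradiction 1≤i 1≰i
  ... | yes _ | no j≰γi = contradiction j≤γi j≰γi

  entry-positive⇒cell : ∀ {i j} → 1 ≤ entry γ F (i , j) → IsCell γ (i , j)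
  entry-positive⇒cell {i} {j} pos with 1 ≤? i | j ≤? γ i
  ... | yes 1≤i | yes j≤γi = 1≤i , j≤γi
  ... | no _ | _ = contradiction pos λ ()
  ... | yes _ | no _ = contradiction pos λ ()

I≡0 : ∀ {x y} → x ≤ y → I x y ≡ 0
I≡0 {x} {y} x≤y with y <ᵇ x | <ᵇ-reflects-< y x
... | false | _ = refl
... | true | ofʸ y<x = contradiction x≤y (<⇒≱ y<x)

≤-chain-not-inversion : ∀ {u v w} → u ≤ v → v ≤ w → I u v + I v w ≢ 1 + I u w
≤-chain-not-inversion u≤v v≤w eq
  rewrite I≡0 u≤v | I≡0 v≤w | I≡0 (≤-trans u≤v v≤w) = 0≢1+n eq

module SemiSkyline (γ : ℕ → ℕ) (F : ℕ → ℕ → ℕ) (ssaf : IsSSAF γ F) where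

  open Entries γ F

  no-descent : NoDescents γ F
  no-descent = proj₁ (proj₂ ssaf)

  inversion-A : TypeAInversions γ F
  inversion-A = proj₁ (proj₂ (proj₂ ssaf))

  inversion-B : TypeBInversions γ F
  inversion-B = proj₂ (proj₂ (proj₂ ssaf))

  entry-absent-right : ∀ {a b j} → a < b → IsCell γ (a , suc j) → IsCell γ (b , suc j) →
                       F b (suc j) ≢ F a (suc j)
  entry-absent-right {a} {b} {j} a<b cellA cellB same with γ b ≤? γ a
  ... | yes γb≤γa = ≤-chain-not-inversion (≤-reflexive (sym same))
                      (subst (_≤ F a j) (sym same) (no-descent a j cellA))
                      (inversion-A a b j (proj₁ cellA) a<b γb≤γa cellA cellB)
  ... | no γb≰γa = ≤-chain-not-inversion (subst (F b (2 + j) ≤_) same (no-descent b (suc j) cellB↑))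
                     (≤-reflexive (sym same))
                     (inversion-B a b (suc j) (proj₁ cellA) a<b γa<γb cellA cellB cellB↑)
    where
    γa<γb = ≰⇒> γb≰γa
    cellB↑ : IsCell γ (b , 2 + j)
    cellB↑ = proj₁ cellB , <-≤-trans (s≤s (proj₂ cellA)) γa<γb

  entry-absent-left-below : ∀ {a b j} → b < a → IsCell γ (a , suc j) → IsCell γ (b , j) →
                            F b j ≢ F a (suc j)
  entry-absent-left-below {a} {b} {j} b<a cellA cellB same with γ a ≤? γ b
  ... | yes γa≤γb = ≤-chain-not-inversion (subst (F b (suc j) ≤_) same (no-descent b j cellB↑))
                      (≤-reflexive (sym same))
                      (inversion-A b a j (proj₁ cellB) b<a γa≤γb cellB↑ cellA)
    where
    cellB↑ : IsCell γ (b , suc j)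
    cellB↑ = proj₁ cellB , ≤-trans (proj₂ cellA) γa≤γb
  ... | no γa≰γb = ≤-chain-not-inversion (≤-reflexive (sym same))
                     (subst (_≤ F a j) (sym same) (no-descent a j cellA))
                     (inversion-B b a j (proj₁ cellB) b<a (≰⇒> γa≰γb) cellB cellA↓ cellA)
    where
    cellA↓ : IsCell γ (a , j)
    cellA↓ = proj₁ cellA , ≤-trans (n≤1+n j) (proj₂ cellA)

  entry-absent-between : ∀ {a j c} → IsCell γ (a , suc j) → IsCell γ c →
                         (a , suc j) ≺ c → c ≺ (a , j) → ¬ HasEntry F (F a (suc j)) c
  entry-absent-between cellA cellC (inj₁ r<1+j) (inj₁ j<r) = contradiction r<1+j (≤⇒≯ j<r)
  entry-absent-between cellA cellC (inj₁ _) (inj₂ (refl , b<a)) = entry-absent-left-below b<a cellA cellC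
  entry-absent-between cellA cellC (inj₂ (refl , a<b)) _ = entry-absent-right a<b cellA cellC

  skipped-entry-repeats-above : ∀ {x i j} → 1 ≤ x → IsCell γ (i , j) → HasEntry F x (i , j) →
                                ¬ Places γ F x (i , j) → IsCell γ (i , suc j) × HasEntry F x (i , suc j)
  skipped-entry-repeats-above {x} {i} {j} 1≤x cell Fij≡x skipped with entry γ F (i , suc j) <? x
  ... | yes above<x = contradiction (≤-reflexive (sym (trans (entry-cell cell) Fij≡x)) , above<x) skipped
  ... | no above≮x = cell↑ , ≤-antisym (subst (F i (suc j) ≤_) Fij≡x (no-descent i j cell↑))
                                       (subst (x ≤_) (entry-cell cell↑) x≤above)
    where
    x≤above = ≮⇒≥ above≮x
    cell↑ = entry-positive⇒cell (≤-trans 1≤x x≤above)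

module Insertion (γ : ℕ → ℕ) (F : ℕ → ℕ → ℕ) (N : ℕ) (vanish : ∀ i → N < i → γ i ≡ 0)
                 (ssaf : IsSSAF γ F) where

  open Entries γ F
  open SemiSkyline γ F ssaf

  entry-positive : ∀ {i j} → IsCell γ (i , j) → 1 ≤ F i j
  entry-positive {i} {j} = proj₁ (proj₁ ssaf) i j

  basement-cell : ∀ {x} → 1 ≤ x → IsCell γ (x , 0) × HasEntry F x (x , 0)
  basement-cell 1≤x = (1≤x , z≤n) , proj₂ (proj₁ ssaf) _ 1≤x

  row-bounded : ∃ λ H → ∀ {c} → IsCell γ c → row c ≤ H
  row-bounded with eventually-zero⇒bounded N vanish
  ... | H , bound = H , λ { {i , j} (_ , j≤γi) → ≤-trans j≤γi (bound i) }

  col-bounded : ∀ {c} → IsCell γ c → 0 < row c → col c ≤ N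
  col-bounded {i , j} (_ , j≤γi) 0<j with i ≤? N
  ... | yes i≤N = i≤N
  ... | no i≰N = contradiction (subst (j ≤_) (vanish i (≰⇒> i≰N)) j≤γi) (<⇒≱ 0<j)

  first-occurrence : ∀ {m x c} → IsCell γ c → After m c → HasEntry F x c →
                     Σ Cell (FirstCell γ m (HasEntry F x))
  first-occurrence {m} {x} cell after has
    with first-in-reading-order occurs? (λ occ → proj₂ row-bounded (proj₁ occ))
                                        (λ occ → col-bounded (proj₁ occ)) (cell , after , has)
    where
    after? : ∀ m c → Dec (After m c)
    after? nothing c = yes tt
    after? (just (i , j)) (i′ , j′) = (j′ <? j) ⊎-dec ((j ≟ j′) ×-dec (i <? i′))
    occurs? : Decidable λ c → IsCell γ c × After m c × HasEntry F x c
    occurs? (i , j) = ((1 ≤? i) ×-dec (j ≤? γ i)) ×-dec (after? m (i , j) ×-dec (F i j ≟ x))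
  ... | α , (cellα , afterα , hasα) , earlier =
    α , cellα , afterα , hasα , λ c′ cell′ after′ c′≺α has′ → earlier c′≺α (cell′ , after′ , has′)

  -- ScanState p m x: x is to be inserted, p is where the previous value was
  -- placed, and the scan resumes after m.
  data ScanState : Maybe Cell → Maybe Cell → ℕ → Set where
    start  : ∀ {x} → 1 ≤ x → ScanState nothing nothing x
    bumped : ∀ {a j} → IsCell γ (a , suc j) → F a (suc j) < F a j →
             ScanState (just (a , suc j)) (just (a , j)) (F a (suc j))

  scanned-positive : ∀ {p m x} → ScanState p m x → 1 ≤ x
  scanned-positive (start 1≤x) = 1≤x
  scanned-positive (bumped cell _) = entry-positive cell

  basement-after : ∀ {p m x} → ScanState p m x → After p (x , 0)
  basement-after (start _) = tt
  basement-after (bumped _ _) = inj₁ z<s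

  above-after : ∀ {p m x c} → ScanState p m x → After m c → After p (above c)
  above-after (start _) _ = tt
  above-after (bumped _ _) m≺c = above-mono-≺ m≺c

  occurrence-after-scan : ∀ {p m x c} → ScanState p m x → IsCell γ c → After p c →
                          HasEntry F x c → After m c
  occurrence-after-scan (start _) _ _ _ = tt
  occurrence-after-scan {c = c} (bumped {a} {j} cell drop) cellC p≺c has with ≺-trichotomy c (a , j)
  ... | inj₁ c≺m = contradiction has (entry-absent-between cell cellC p≺c c≺m)
  ... | inj₂ (inj₁ refl) = contradiction (sym has) (<⇒≢ drop)
  ... | inj₂ (inj₂ m≺c) = m≺c

  first-occurrence-lower : ∀ {p m x a j} → ScanState p m x → FirstCell γ m (Places γ F x) (a , j) →
                           Σ Cell λ α → FirstCell γ p (HasEntry F x) α × row α < suc j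
  first-occurrence-lower {j = j} st (_ , _ , _ , unscanned)
    with first-occurrence (proj₁ (basement-cell (scanned-positive st))) (basement-after st)
                          (proj₂ (basement-cell (scanned-positive st)))
  ... | α@(_ , r) , occ@(cellα , afterα , hasα , earlier) with r ≤? j
  ...   | yes r≤j = α , occ , s≤s r≤j
  ...   | no r≰j =
    contradiction (proj₂ repeat) (earlier (above α) (proj₁ repeat) (above-after st scanned) (above-≺ α))
    where
    scanned = occurrence-after-scan st cellα afterα hasα
    repeat = skipped-entry-repeats-above (scanned-positive st) cellα hasα
               (unscanned α cellα scanned (inj₁ (≰⇒> r≰j)))

  next-state : ∀ {m x a j} → FirstCell γ m (Places γ F x) (a , j) → entry γ F (a , suc j) ≢ 0 →
               ScanState (just (a , suc j)) (just (a , j)) (entry γ F (a , suc j))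
  next-state (cell , _ , (x≤e , e↑<x) , _) nonzero =
    subst (ScanState _ _) (sym (entry-cell cell↑))
      (bumped cell↑ (subst₂ _<_ (entry-cell cell↑) (entry-cell cell) (<-≤-trans e↑<x x≤e)))
    where
    cell↑ = entry-positive⇒cell (n≢0⇒n>0 nonzero)

  FirstOccurrenceLower : Maybe Cell × ℕ × Cell → Set
  FirstOccurrenceLower = λ { (prev , x , p) → Σ Cell (λ α → FirstCell γ prev (HasEntry F x) α × row α < row p) }

  insertion-lower : ∀ {p m x steps} → ScanState p m x → InsRun γ F m x steps →
                    All FirstOccurrenceLower (withPrev p steps)
  insertion-lower st (stop _ first _) = first-occurrence-lower st first ∷ []
  insertion-lower st (continue _ first nonzero rest) =
    first-occurrence-lower st first ∷ insertion-lower (next-state first nonzero) rest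

lemma3p4 : (γ : ℕ → ℕ) (F : ℕ → ℕ → ℕ) → IsWeakComposition γ → IsSSAF γ F →
    (k : ℕ) → 1 ≤ k → (steps : List (ℕ × Cell)) → InsRun γ F nothing k steps →
    All (λ { (prev , x , p) → Σ Cell (λ α → FirstCell γ prev (HasEntry F x) α × row α < row p) })
      (withPrev nothing steps)
lemma3p4 γ F (N , vanish) ssaf k 1≤k steps run = insertion-lower (start 1≤k) run
  where open Insertion γ F N vanish ssaf
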